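{- Let $s\ge1$ and let $\pi$ be a Rogers–Ramanujan partition with $s$ successive lower-Durfee squares. Then $\pi$ has exactly $s$ successive Durfee squares; moreover the lower-Durfee squares form the Durfee squares, i.e. for each $i=1,\dots,s$ the $i$-th successive Durfee square (counted from the top) coincides (same rows, same side) with the $(s+1-i)$-th lower-Durfee square (counted from the bottom).
   Context: Write a partition $\pi$ as $\lambda_1\ge\dots\ge\lambda_\ell$, row $i$ of its Ferrers diagram (from the top) of length $\lambda_i$. Successive Durfee squares: the first has side $D_1=\max\{i:\lambda_i\ge i\}$ and occupies the first $D_1$ columns of rows $1,\dots,D_1$; the second is the first Durfee square of the partition $\lambda_{D_1+1}\ge\lambda_{D_1+2}\ge\cdots$ (placed in those rows), and so on until no parts remain; $\pi$ has exactly $s$ successive Durfee squares if this process produces exactly $s$ squares. Successive lower-Durfee squares: set $r_0=\ell$; if $r_{t-1}\ge1$ let $d_t=\min(\lambda_{r_{t-1}},r_{t-1})$, the $t$-th lower-Durfee square being the $d_t\times d_t$ square in the first $d_t$ columns of rows $r_{t-1}-d_t+1,\dots,r_{t-1}$, and $r_t=r_{t-1}-d_t$; stop when $r_t=0$. $\pi$ has exactly $s$ successive lower-Durfee squares if the process produces exactly $s$ squares. $\pi$ is a Rogers–Ramanujan partition with $s$ successive lower-Durfee squares if it has exactly $s$ successive lower-Durfee squares and every part lying below the $s$-th lower-Durfee square is $\le d_s$. -}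

module Defs where

open import Data.Nat using (ℕ; zero; suc; _+_; _∸_; _≤_; _≥_; _⊔_; _⊓_; _≤ᵇ_)
open import Data.Bool using (if_then_else_)
open import Data.List using (List; []; _∷_; length; drop; map; upTo; foldr; reverse)
open import Data.List.Relation.Unary.All using (All)
open import Data.List.Relation.Unary.Linked using (Linked)
open import Data.Product using (_×_; _,_)
open import Relation.Binary.PropositionalEquality using (_≡_)

IsPartition : List ℕ → Set
IsPartition xs = Linked _≥_ xs × All (λ x → 1 ≤ x) xs

-- λ_i (1-indexed); 0 outside 1..ℓ
part : List ℕ → ℕ → ℕ
part []       _             = 0
part (x ∷ xs) zero          = 0
part (x ∷ xs) (suc zero)    = x
part (x ∷ xs) (suc (suc i)) = part xs (suc i)

-- side of the (first) Durfee square: max { i ∈ 1..ℓ : λ_i ≥ i }  (0 if empty)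
durfeeSide : List ℕ → ℕ
durfeeSide xs =
  foldr _⊔_ 0 (map (λ i → if suc i ≤ᵇ part xs (suc i) then suc i else 0)
                   (upTo (length xs)))

-- A square recorded as (top row, side); rows are 1-indexed from the top,
-- the square occupying rows top, …, top + side - 1 and columns 1..side.
Square : Set
Square = ℕ × ℕ

-- Successive Durfee squares (top to bottom).  `off` = number of rows above
-- the remaining partition; fuel bounds the recursion (fuel = ℓ suffices,
-- since each square has side ≥ 1 for a partition).
durfeeSquaresAux : ℕ → ℕ → List ℕ → List Square
durfeeSquaresAux zero     off xs       = []
durfeeSquaresAux (suc f)  off []       = []
durfeeSquaresAux (suc f)  off (x ∷ xs) =
  let D = durfeeSide (x ∷ xs) in
  (suc off , D) ∷ durfeeSquaresAux f (off + D) (drop D (x ∷ xs))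

durfeeSquares : List ℕ → List Square
durfeeSquares xs = durfeeSquaresAux (length xs) 0 xs

-- Successive lower-Durfee squares (listed in order of construction, i.e.
-- bottom to top): from r_{t-1} ≥ 1, d_t = min(λ_{r_{t-1}}, r_{t-1}),
-- square in rows r_{t-1}-d_t+1 .. r_{t-1}, r_t = r_{t-1} - d_t.
lowerSquaresAux : ℕ → List ℕ → ℕ → List Square
lowerSquaresAux zero    xs r       = []
lowerSquaresAux (suc f) xs zero    = []
lowerSquaresAux (suc f) xs (suc r) =
  let d = part xs (suc r) ⊓ suc r in
  (suc (suc r ∸ d) , d) ∷ lowerSquaresAux f xs (suc r ∸ d)

lowerSquares : List ℕ → List Square
lowerSquares xs = lowerSquaresAux (length xs) xs (length xs)

-- π is a Rogers–Ramanujan partition with s successive lower-Durfee squares: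
-- exactly s lower-Durfee squares, and every part in a row below the s-th one
-- (rows r_{s-1}+1 .. ℓ, where the s-th square has top row 1 and side d_s,
-- i.e. rows below row d_s) is ≤ d_s.
data Last {A : Set} : List A → A → Set where
  last-here  : ∀ {a}          → Last (a ∷ []) a
  last-there : ∀ {a b as z}   → Last (b ∷ as) z → Last (a ∷ b ∷ as) z

IsRRLower : ℕ → List ℕ → Set
IsRRLower s xs =
  IsPartition xs × length (lowerSquares xs) ≡ s ×
  (∀ top d → Last (lowerSquares xs) (top , d) →
     ∀ i → top + d ≤ i → i ≤ length xs → part xs i ≤ d)

module Submission where

-- Read the lower-Durfee construction from the top down:
-- it is a run from r = ℓ down to r = 0, and at a step from r+1 it cuts the
-- square of side d = min(λ_{r+1}, r+1) whose top row is lo + 1, lo = r + 1 - d.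
-- If such a square is not the topmost one (lo ≥ 1) then d = λ_{r+1}, so by
-- monotonicity every part below it is ≤ d; for the topmost square the same
-- bound is exactly the Rogers–Ramanujan hypothesis.  A d × d square with
-- λ_{lo+d} ≥ d and all parts below row lo + d at most d is precisely the
-- first Durfee square of the partition λ_{lo+1} ≥ λ_{lo+2} ≥ …, so the
-- successive Durfee construction started at row lo + 1 reproduces the
-- squares of the run one by one.

open import Defs
open import Data.Nat using (ℕ; _≥_)
open import Data.List using (List; reverse; length)
open import Data.Product using (_×_)
open import Relation.Binary.PropositionalEquality using (_≡_)

open import Data.Nat using (zero; suc; _+_; _∸_; _≤_; _<_; _⊔_; _⊓_; _≤ᵇ_; z≤n; s≤s; s≤s⁻¹; _≤?_)
open import Data.Nat.Properties
open import Data.Bool using (true; false; if_then_else_; T)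
open import Data.List using ([]; _∷_; drop; map; upTo; foldr; _++_; _∷ʳ_)
open import Data.List.Properties using (drop-all; drop-drop; unfold-reverse; reverse-involutive; length-reverse; ∷ʳ-++; ++-identityʳ; foldr-preservesᵇ)
open import Data.List.Relation.Unary.All as All using (All; _∷_)
open import Data.List.Relation.Unary.All.Properties using (map⁺)
open import Data.List.Relation.Unary.Linked as Linked using (Linked; _∷_)
open import Data.List.Membership.Propositional using (_∈_)
open import Data.List.Membership.Propositional.Properties using (∈-upTo⁺; ∈-map⁺)
open import Data.List.Relation.Unary.Any using (here; there)
open import Data.Product using (_,_; proj₁; proj₂)
open import Data.Unit using (⊤; tt)
open import Relation.Nullary using (yes; no; contradiction)
open import Relation.Binary.PropositionalEquality using (refl; sym; trans; cong; subst; module ≡-Reasoning)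

foldr-⊔-lub : ∀ {d} (ys : List ℕ) → All (_≤ d) ys → foldr _⊔_ 0 ys ≤ d
foldr-⊔-lub ys = foldr-preservesᵇ ⊔-lub z≤n

foldr-⊔-ub : ∀ {x} (ys : List ℕ) → x ∈ ys → x ≤ foldr _⊔_ 0 ys
foldr-⊔-ub (y ∷ ys) (here refl) = m≤m⊔n y _
foldr-⊔-ub (y ∷ ys) (there x∈) = ≤-trans (foldr-⊔-ub ys x∈) (m≤n⊔m y _)

part-pos⇒index≤length : ∀ (xs : List ℕ) j → 1 ≤ part xs (suc j) → suc j ≤ length xs
part-pos⇒index≤length (x ∷ xs) zero    _   = s≤s z≤n
part-pos⇒index≤length (x ∷ xs) (suc j) pos = s≤s (part-pos⇒index≤length xs j pos)

part-drop : ∀ lo (xs : List ℕ) j → part (drop lo xs) (suc j) ≡ part xs (suc (lo + j))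
part-drop zero     xs       j = refl
part-drop (suc lo) []       j = refl
part-drop (suc lo) (x ∷ xs) j = part-drop lo xs j

part-beyond : ∀ (xs : List ℕ) i → length xs < i → part xs i ≡ 0
part-beyond []       i             _       = refl
part-beyond (x ∷ xs) (suc (suc i)) (s≤s p) = part-beyond xs (suc i) p

part≤head : ∀ {x xs} → Linked _≥_ (x ∷ xs) → ∀ j → part (x ∷ xs) (suc j) ≤ x
part≤head             _           zero    = ≤-refl
part≤head {xs = []}    _          (suc j) = z≤n
part≤head {xs = y ∷ _} (x≥y ∷ ys) (suc j) = ≤-trans (part≤head ys j) x≥y

part-antitone : ∀ {xs} → Linked _≥_ xs → ∀ {i j} → i ≤ j → part xs (suc j) ≤ part xs (suc i)
part-antitone {[]}    _      _                         = z≤n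
part-antitone {_ ∷ _} sorted {zero}  {j}     _         = part≤head sorted j
part-antitone {_ ∷ _} sorted {suc i} {suc j} (s≤s i≤j) = part-antitone (Linked.tail sorted) i≤j

part-pos : ∀ {xs : List ℕ} → All (1 ≤_) xs → ∀ {i} → i < length xs → 1 ≤ part xs (suc i)
part-pos (p ∷ _)  {zero}  _         = p
part-pos (_ ∷ ps) {suc i} (s≤s i<ℓ) = part-pos ps i<ℓ

PartsFrom≤ : List ℕ → ℕ → ℕ → Set
PartsFrom≤ xs b d = ∀ i → b ≤ i → part xs i ≤ d

partsFrom≤-inRange : ∀ (xs : List ℕ) b d →
  (∀ i → b ≤ i → i ≤ length xs → part xs i ≤ d) → PartsFrom≤ xs b d
partsFrom≤-inRange xs b d bound i b≤i with i ≤? length xs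
... | yes i≤ℓ = bound i b≤i i≤ℓ
... | no  i≰ℓ = subst (_≤ d) (sym (part-beyond xs i (≰⇒> i≰ℓ))) z≤n

-- The Durfee side is d as soon as λ_d ≥ d and every later part is ≤ d:
-- no row i > d can satisfy λ_i ≥ i, while row d does.

durfeeSide-unique : ∀ (ys : List ℕ) d → d ≤ part ys d → PartsFrom≤ ys (suc d) d →
  durfeeSide ys ≡ d
durfeeSide-unique ys d corner below = ≤-antisym upper (lower d corner)
  where
  candidate : ℕ → ℕ
  candidate i = if suc i ≤ᵇ part ys (suc i) then suc i else 0

  candidate≤ : ∀ i → candidate i ≤ d
  candidate≤ i with suc i ≤ᵇ part ys (suc i) in fits
  ... | false = z≤n
  ... | true with suc i ≤? d
  ...   | yes i<d = i<d
  ...   | no  i≮d = contradiction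
      (≤-trans (≤ᵇ⇒≤ (suc i) _ (subst T (sym fits) tt)) (below (suc i) (≰⇒> i≮d)))
      (<⇒≱ (≰⇒> i≮d))

  upper : durfeeSide ys ≤ d
  upper = foldr-⊔-lub _ (map⁺ (All.universal candidate≤ (upTo (length ys))))

  -- the row e itself is a candidate of value e
  lower : ∀ e → e ≤ part ys e → e ≤ durfeeSide ys
  lower zero     _      = z≤n
  lower (suc e) corner′ = subst (_≤ durfeeSide ys) candidate≡
    (foldr-⊔-ub _ (∈-map⁺ candidate (∈-upTo⁺ e<ℓ)))
    where
    e<ℓ : e < length ys
    e<ℓ = part-pos⇒index≤length ys e (≤-trans (s≤s z≤n) corner′)
    candidate≡ : candidate e ≡ suc e
    candidate≡ with suc e ≤ᵇ part ys (suc e) in fits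
    ... | true  = refl
    ... | false = contradiction (subst T fits (≤⇒≤ᵇ corner′)) (λ ())

durfee-nil : ∀ f off → durfeeSquaresAux f off [] ≡ []
durfee-nil zero    off = refl
durfee-nil (suc f) off = refl

durfee-cons : ∀ f off (ys : List ℕ) → 1 ≤ length ys →
  durfeeSquaresAux (suc f) off ys ≡
    (suc off , durfeeSide ys) ∷ durfeeSquaresAux f (off + durfeeSide ys) (drop (durfeeSide ys) ys)
durfee-cons f off (y ∷ ys) _ = refl

durfee-next : ∀ f (xs : List ℕ) lo d → 1 ≤ d → d ≤ part xs (lo + d) →
  PartsFrom≤ xs (suc (lo + d)) d →
  durfeeSquaresAux (suc f) lo (drop lo xs) ≡
    (suc lo , d) ∷ durfeeSquaresAux f (lo + d) (drop (lo + d) xs)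
durfee-next f xs lo d@(suc e) _ corner below = begin
    durfeeSquaresAux (suc f) lo ys
  ≡⟨ durfee-cons f lo ys nonempty ⟩
    (suc lo , durfeeSide ys) ∷ durfeeSquaresAux f (lo + durfeeSide ys) (drop (durfeeSide ys) ys)
  ≡⟨ cong (λ D → (suc lo , D) ∷ durfeeSquaresAux f (lo + D) (drop D ys)) side≡d ⟩
    (suc lo , d) ∷ durfeeSquaresAux f (lo + d) (drop d ys)
  ≡⟨ cong (λ zs → (suc lo , d) ∷ durfeeSquaresAux f (lo + d) zs) (drop-drop lo d xs) ⟩
    (suc lo , d) ∷ durfeeSquaresAux f (lo + d) (drop (lo + d) xs)
  ∎
  where
  open ≡-Reasoning
  ys : List ℕ
  ys = drop lo xs

  corner′ : d ≤ part ys d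
  corner′ = subst (d ≤_) (trans (cong (part xs) (+-suc lo e)) (sym (part-drop lo xs e))) corner

  below′ : PartsFrom≤ ys (suc d) d
  below′ (suc j) d<j = subst (_≤ d) (sym (part-drop lo xs j))
    (below (suc (lo + j)) (s≤s (+-monoʳ-≤ lo (s≤s⁻¹ d<j))))

  nonempty : 1 ≤ length ys
  nonempty = ≤-trans (s≤s z≤n) (part-pos⇒index≤length ys e (≤-trans (s≤s z≤n) corner′))

  side≡d : durfeeSide ys ≡ d
  side≡d = durfeeSide-unique ys d corner′ below′

lowerSquaresAux-length : ∀ f (xs : List ℕ) r → length (lowerSquaresAux f xs r) ≤ f
lowerSquaresAux-length zero    xs r       = z≤n
lowerSquaresAux-length (suc f) xs zero    = z≤n
lowerSquaresAux-length (suc f) xs (suc r) = s≤s (lowerSquaresAux-length f xs _)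

last-snoc : ∀ {A : Set} (as : List A) z → Last (as ∷ʳ z) z
last-snoc []           z = last-here
last-snoc (a ∷ [])     z = last-there last-here
last-snoc (a ∷ b ∷ bs) z = last-there (last-snoc (b ∷ bs) z)

last-of-reverse : ∀ {A : Set} (L : List A) {z M} → reverse L ≡ z ∷ M → Last L z
last-of-reverse L {z} {M} rev≡ = subst (λ X → Last X z) L≡ (last-snoc (reverse M) z)
  where
  L≡ : reverse M ∷ʳ z ≡ L
  L≡ = trans (sym (unfold-reverse z M)) (trans (cong reverse (sym rev≡)) (reverse-involutive L))

module LowerRun (xs : List ℕ) (isPart : IsPartition xs) where

  ℓ : ℕ
  ℓ = length xs

  -- the square cut when the construction stands at row r + 1
  side : ℕ → ℕ
  side r = part xs (suc r) ⊓ suc r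

  square : ℕ → Square
  square r = (suc (suc r ∸ side r) , side r)

  -- Run r M: started at row ℓ, the construction reaches r, having cut the
  -- squares M (listed from the top down).
  data Run : ℕ → List Square → Set where
    start : Run ℓ []
    step  : ∀ {r M} → Run (suc r) M → Run (suc r ∸ side r) (square r ∷ M)

  run-bound : ∀ {r M} → Run r M → r ≤ ℓ
  run-bound start             = ≤-refl
  run-bound (step {r} run) = ≤-trans (m∸n≤m (suc r) (side r)) (run-bound run)

  side-pos : ∀ {r} → suc r ≤ ℓ → 1 ≤ side r
  side-pos r<ℓ = ⊓-glb (part-pos (proj₂ isPart) r<ℓ) (s≤s z≤n)

  side-fits : ∀ r → (suc r ∸ side r) + side r ≡ suc r
  side-fits r = m∸n+n≡m (m⊓n≤n (part xs (suc r)) (suc r))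

  side-inner : ∀ r → 1 ≤ suc r ∸ side r → side r ≡ part xs (suc r)
  side-inner r above with part xs (suc r) ≤? suc r
  ... | yes λ≤r = m≤n⇒m⊓n≡m λ≤r
  ... | no  λ≰r = contradiction (subst (1 ≤_) (n∸n≡0 (suc r)) above′) (λ ())
    where
    above′ : 1 ≤ suc r ∸ suc r
    above′ = subst (λ d → 1 ≤ suc r ∸ d) (m≥n⇒m⊓n≡n (<⇒≤ (≰⇒> λ≰r))) above

  run-lowerSquares : ∀ f r M → Run r M → r ≤ f → Run 0 (reverse (lowerSquaresAux f xs r) ++ M)
  run-lowerSquares zero    zero    M run _         = run
  run-lowerSquares (suc f) zero    M run _         = run
  run-lowerSquares (suc f) (suc r) M run (s≤s r≤f) =
    subst (Run 0) rearrange (run-lowerSquares f (suc r ∸ side r) (square r ∷ M) (step run) fuel)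
    where
    rest : List Square
    rest = lowerSquaresAux f xs (suc r ∸ side r)
    fuel : suc r ∸ side r ≤ f
    fuel = ≤-trans (∸-monoʳ-≤ (suc r) (side-pos (run-bound run))) r≤f
    rearrange : reverse rest ++ square r ∷ M ≡ reverse (square r ∷ rest) ++ M
    rearrange = sym (trans (cong (_++ M) (unfold-reverse (square r) rest))
                           (∷ʳ-++ (reverse rest) (square r) M))

  TopBounded : List Square → Set
  TopBounded []              = ⊤
  TopBounded ((top , d) ∷ _) = PartsFrom≤ xs (top + d) d

  topBounded-reverse : ∀ L →
    (∀ top d → Last L (top , d) → ∀ i → top + d ≤ i → i ≤ ℓ → part xs i ≤ d) →
    TopBounded (reverse L)
  topBounded-reverse L bound with reverse L in rev≡
  ... | []            = tt
  ... | (top , d) ∷ M = partsFrom≤-inRange xs (top + d) d (bound top d (last-of-reverse L rev≡))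

  -- below a row r ≥ 1 the bound holds automatically, by monotonicity
  inner-topBounded : ∀ {r M} → Run r M → 1 ≤ r → TopBounded M
  inner-topBounded start          _     = tt
  inner-topBounded (step {r} run) above i below-square =
    subst (part xs i ≤_) (sym (side-inner r above)) (decreasing i below-row)
    where
    below-row : suc (suc r) ≤ i
    below-row = subst (λ b → suc b ≤ i) (side-fits r) below-square
    decreasing : ∀ k → suc (suc r) ≤ k → part xs k ≤ part xs (suc r)
    decreasing (suc k) (s≤s r<k) = part-antitone (proj₁ isPart) (<⇒≤ r<k)

  run-durfee : ∀ {lo M} → Run lo M → TopBounded M → ∀ f → length M ≤ f →
    durfeeSquaresAux f lo (drop lo xs) ≡ M
  run-durfee start _ f _ =
    trans (cong (durfeeSquaresAux f ℓ) (drop-all ℓ xs ≤-refl)) (durfee-nil f ℓ)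
  run-durfee (step {r} {M} run) topBound (suc f) (s≤s fuel) = begin
      durfeeSquaresAux (suc f) lo (drop lo xs)
    ≡⟨ durfee-next f xs lo d (side-pos (run-bound run)) corner topBound ⟩
      square r ∷ durfeeSquaresAux f (lo + d) (drop (lo + d) xs)
    ≡⟨ cong (λ b → square r ∷ durfeeSquaresAux f b (drop b xs)) (side-fits r) ⟩
      square r ∷ durfeeSquaresAux f (suc r) (drop (suc r) xs)
    ≡⟨ cong (square r ∷_) (run-durfee run (inner-topBounded run (s≤s z≤n)) f fuel) ⟩
      square r ∷ M
    ∎
    where
    open ≡-Reasoning
    d lo : ℕ
    d  = side r
    lo = suc r ∸ d
    corner : d ≤ part xs (lo + d)
    corner = subst (λ b → d ≤ part xs b) (sym (side-fits r)) (m⊓n≤m _ _)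

lemma3p2 : (s : ℕ) → s ≥ 1 → (π : List ℕ) → IsRRLower s π →
    length (durfeeSquares π) ≡ s × durfeeSquares π ≡ reverse (lowerSquares π)
lemma3p2 s _ π (isPart , count , rrBound) =
  trans (cong length durfee≡lower) (trans (length-reverse L) count) , durfee≡lower
  where
  open LowerRun π isPart
  L : List Square
  L = lowerSquares π

  run : Run 0 (reverse L)
  run = subst (Run 0) (++-identityʳ (reverse L))
          (run-lowerSquares (length π) (length π) [] start ≤-refl)

  fuel : length (reverse L) ≤ length π
  fuel = subst (_≤ length π) (sym (length-reverse L))
           (lowerSquaresAux-length (length π) π (length π))

  durfee≡lower : durfeeSquares π ≡ reverse L
  durfee≡lower = run-durfee run (topBounded-reverse L rrBound) (length π) fuel
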